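{- Let $f:\mathbb{N}\to\mathbb{R}$ be a nonnegative multiplicative function with $f(1)=1$. If for every prime $p$ and all integers $a,b\ge0$ one has $f(p^{a+b})\le p^a f(p^b)$ (resp. $f(p^{a+b})\ge p^a f(p^b)$), then $f$ is sub-homogeneous (resp. super-homogeneous).
   Context: $\mathbb{N}=\{1,2,3,\dots\}$. $f$ is multiplicative if $f(mn)=f(m)f(n)$ whenever $\gcd(m,n)=1$. $f$ is sub-homogeneous if $f(mn)\le m f(n)$ for all $m,n\ge1$, and super-homogeneous if $f(mn)\ge m f(n)$ for all $m,n\ge1$. -}

module Defs where

open import Level using (0ℓ)
open import Algebra.Bundles using (CommutativeRing)
open import Relation.Binary.Core using (Rel)
open import Relation.Binary.Structures using (IsTotalOrder)
open import Relation.Nullary using (¬_)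
open import Data.Product using (∃; _×_)
import Data.Nat as ℕ
open ℕ using (ℕ; zero; suc)
open import Data.Nat.Coprimality using (Coprime)
open import Data.Nat.Primality using (Prime)

-- The real numbers, axiomatised as a complete ordered field
-- (any model is isomorphic to ℝ). The stdlib has no reals.
record RealField : Set₁ where
  field
    commutativeRing : CommutativeRing 0ℓ 0ℓ
  open CommutativeRing commutativeRing public
  infix 4 _≤_
  field
    _≤_          : Rel Carrier 0ℓ
    isTotalOrder : IsTotalOrder _≈_ _≤_
    +-monoˡ-≤    : ∀ {x y} z → x ≤ y → x + z ≤ y + z
    *-nonneg     : ∀ {x y} → 0# ≤ x → 0# ≤ y → 0# ≤ x * y
    0≉1          : ¬ (0# ≈ 1#)
    inverse      : ∀ x → ¬ (x ≈ 0#) → ∃ λ y → x * y ≈ 1#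
    complete     : (S : Carrier → Set) → ∃ S →
                   (∃ λ b → ∀ x → S x → x ≤ b) →
                   ∃ λ s → (∀ x → S x → x ≤ s) ×
                           (∀ b → (∀ x → S x → x ≤ b) → s ≤ b)

module _ (R : RealField) where
  open RealField R

  fromℕ : ℕ → Carrier
  fromℕ zero    = 0#
  fromℕ (suc n) = 1# + fromℕ n

  -- f is only considered on ℕ = {1,2,3,...}; values at 0 are irrelevant.
  Nonnegative : (ℕ → Carrier) → Set
  Nonnegative f = ∀ n → 1 ℕ.≤ n → 0# ≤ f n

  Multiplicative : (ℕ → Carrier) → Set
  Multiplicative f = ∀ m n → 1 ℕ.≤ m → 1 ℕ.≤ n → Coprime m n →
                     f (m ℕ.* n) ≈ f m * f n

  SubHomogeneous : (ℕ → Carrier) → Set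
  SubHomogeneous f = ∀ m n → 1 ℕ.≤ m → 1 ℕ.≤ n →
                     f (m ℕ.* n) ≤ fromℕ m * f n

  SuperHomogeneous : (ℕ → Carrier) → Set
  SuperHomogeneous f = ∀ m n → 1 ℕ.≤ m → 1 ℕ.≤ n →
                       fromℕ m * f n ≤ f (m ℕ.* n)

  PrimePowerSub : (ℕ → Carrier) → Set
  PrimePowerSub f = ∀ p → Prime p → ∀ a b →
                    f (p ℕ.^ (a ℕ.+ b)) ≤ fromℕ (p ℕ.^ a) * f (p ℕ.^ b)

  PrimePowerSuper : (ℕ → Carrier) → Set
  PrimePowerSuper f = ∀ p → Prime p → ∀ a b →
                      fromℕ (p ℕ.^ a) * f (p ℕ.^ b) ≤ f (p ℕ.^ (a ℕ.+ b))

-- Split k = p ^ b * r with p ∤ r. Multiplicativity and the prime-power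
-- hypothesis with a = 1 give f (p k) = f (p ^ (1 + b)) f r ≤ p f (p ^ b) f r
-- = p f k, i.e. multiplying the argument by a prime p scales f by at most p.
-- Iterating this along the prime factorisation of m gives f (m n) ≤ m f n.
-- Both directions are the same argument, run once for ≤ and once for ≥.
{-# OPTIONS --safe #-}
module Submission where

open import Defs
open import Data.Nat using (ℕ)
open import Data.Product using (_×_)

open import Level using (0ℓ)
open import Data.Product using (_,_; ∃₂)
open import Data.Sum using (inj₁; inj₂)
open import Data.List using (_∷_)
open import Data.List.Relation.Unary.All using (All; []; _∷_)
open import Data.Nat using (zero; suc; NonZero)
open import Data.Nat.ListAction using (product)
open import Data.Nat.Divisibility using (_∤_; divides; _∣?_; ∣-trans; _∣0)
open import Data.Nat.Coprimality using (Coprime; coprime-divisor; 1-coprimeTo)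
open import Data.Nat.Primality using (Prime; prime⇒irreducible; prime⇒nonZero; prime⇒nonTrivial; productOfPrimes≥1)
open import Data.Nat.Primality.Factorisation using (factorise; PrimeFactorisation)
open import Relation.Binary.Bundles using (Preorder)
open import Relation.Binary.Structures using (IsPreorder; IsTotalOrder)
open import Relation.Binary.PropositionalEquality as ≡ using (_≡_; refl; cong)
open import Relation.Nullary using (yes; no; contradiction)
import Data.Nat as ℕ
import Data.Nat.Properties as ℕ
import Relation.Binary.Construct.Flip.EqAndOrd as Flip

module _ where
  open import Data.Nat using (_+_; _*_; _^_; _≤_; _<_)
  open import Data.Nat.Properties using (*-identityˡ; *-assoc; *-comm; m<m*n)
  open import Data.Nat.Induction using (<-wellFounded)
  open import Induction.WellFounded using (Acc; acc)

  coprime-*ˡ : ∀ {m n o} → Coprime m o → Coprime n o → Coprime (m * n) o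
  coprime-*ˡ {m} {n} m⊥o n⊥o {d} (d∣mn , d∣o) = n⊥o (coprime-divisor d⊥m d∣mn , d∣o)
    where
    d⊥m : Coprime d m
    d⊥m (e∣d , e∣m) = m⊥o (e∣m , ∣-trans e∣d d∣o)

  coprime-^ˡ : ∀ {m n} → Coprime m n → ∀ b → Coprime (m ^ b) n
  coprime-^ˡ {n = n} m⊥n zero    = 1-coprimeTo n
  coprime-^ˡ         m⊥n (suc b) = coprime-*ˡ m⊥n (coprime-^ˡ m⊥n b)

  prime∤⇒coprime : ∀ {p n} → Prime p → p ∤ n → Coprime p n
  prime∤⇒coprime p-prime p∤n (d∣p , d∣n) with prime⇒irreducible p-prime d∣p
  ... | inj₁ d≡1  = d≡1
  ... | inj₂ refl = contradiction d∣n p∤n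

  prime⇒>1 : ∀ {p} → Prime p → 1 < p
  prime⇒>1 {p} p-prime = ℕ.nonTrivial⇒n>1 p {{prime⇒nonTrivial p-prime}}

  ∤⇒≥1 : ∀ {p r} → p ∤ r → 1 ≤ r
  ∤⇒≥1 {p} {zero}  p∤0 = contradiction (p ∣0) p∤0
  ∤⇒≥1 {r = suc _} _   = ℕ.s≤s ℕ.z≤n

  split-power : ∀ {p} → 1 < p → ∀ k → .{{NonZero k}} →
                ∃₂ λ b r → p ∤ r × k ≡ p ^ b * r
  split-power {p} 1<p k = go k (<-wellFounded k)
    where
    go : ∀ k → .{{NonZero k}} → Acc _<_ k → ∃₂ λ b r → p ∤ r × k ≡ p ^ b * r
    go k (acc rec) with p ∣? k
    ... | no p∤k = 0 , k , p∤k , ≡.sym (*-identityˡ k)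
    ... | yes (divides q@(suc _) k≡q*p) with go q (rec q<k)
      where
      q<k : q < k
      q<k = ≡.subst (q <_) (≡.sym k≡q*p) (m<m*n q p 1<p)
    ...   | b , r , p∤r , q≡pᵇr = suc b , r , p∤r , (begin
        k                ≡⟨ k≡q*p ⟩
        q * p            ≡⟨ cong (_* p) q≡pᵇr ⟩
        p ^ b * r * p    ≡⟨ *-comm (p ^ b * r) p ⟩
        p * (p ^ b * r)  ≡⟨ *-assoc p (p ^ b) r ⟨
        p ^ suc b * r    ∎)
      where open ≡.≡-Reasoning
    go zero {{()}} _ | yes (divides zero _)
    go (suc _) _     | yes (divides zero ())

module _ (R : RealField) where
  open RealField R
  open import Algebra.Properties.Ring ring using (-‿distribˡ-*; -‿distribʳ-*; -‿involutive; x[y-z]≈xy-xz)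
  open import Algebra.Properties.Semiring.Mult semiring using (×1-homo-*) renaming (_×_ to _·_)
  private module ≤ = IsTotalOrder isTotalOrder

  ≤-isPreorder : IsPreorder _≈_ _≤_
  ≤-isPreorder = ≤.isPreorder

  ≤-preorder : Preorder 0ℓ 0ℓ 0ℓ
  ≤-preorder = record { isPreorder = ≤-isPreorder }

  module _ where
    open import Relation.Binary.Reasoning.Preorder ≤-preorder

    x≤y⇒0≤y-x : ∀ {x y} → x ≤ y → 0# ≤ y - x
    x≤y⇒0≤y-x {x} {y} x≤y = begin
      0#     ≈⟨ -‿inverseʳ x ⟨
      x - x  ≲⟨ +-monoˡ-≤ (- x) x≤y ⟩
      y - x  ∎

    0≤y-x⇒x≤y : ∀ {x y} → 0# ≤ y - x → x ≤ y
    0≤y-x⇒x≤y {x} {y} 0≤y-x = begin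
      x              ≈⟨ +-identityˡ x ⟨
      0# + x         ≲⟨ +-monoˡ-≤ x 0≤y-x ⟩
      y - x + x      ≈⟨ +-assoc y (- x) x ⟩
      y + (- x + x)  ≈⟨ +-congˡ (-‿inverseˡ x) ⟩
      y + 0#         ≈⟨ +-identityʳ y ⟩
      y              ∎

    x*x≥0 : ∀ x → 0# ≤ x * x
    x*x≥0 x with ≤.total 0# x
    ... | inj₁ 0≤x = *-nonneg 0≤x 0≤x
    ... | inj₂ x≤0 = begin
      0#           ≲⟨ *-nonneg 0≤-x 0≤-x ⟩
      - x * - x    ≈⟨ -‿distribˡ-* x (- x) ⟨
      - (x * - x)  ≈⟨ -‿cong (-‿distribʳ-* x x) ⟨
      - - (x * x)  ≈⟨ -‿involutive (x * x) ⟩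
      x * x        ∎
      where
      0≤-x : 0# ≤ - x
      0≤-x = ≤.≲-respʳ-≈ (+-identityˡ (- x)) (x≤y⇒0≤y-x x≤0)

    0≤1 : 0# ≤ 1#
    0≤1 = ≤.≲-respʳ-≈ (*-identityˡ 1#) (x*x≥0 1#)

    *-monoʳ-≤-nonNeg : ∀ {c x y} → 0# ≤ c → x ≤ y → c * x ≤ c * y
    *-monoʳ-≤-nonNeg {c} {x} {y} 0≤c x≤y =
      0≤y-x⇒x≤y (≤.≲-respʳ-≈ (x[y-z]≈xy-xz c y x) (*-nonneg 0≤c (x≤y⇒0≤y-x x≤y)))

    fromℕ≥0 : ∀ n → 0# ≤ fromℕ R n
    fromℕ≥0 zero    = ≤.refl
    fromℕ≥0 (suc n) = begin
      0#               ≈⟨ +-identityˡ 0# ⟨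
      0# + 0#          ≲⟨ +-monoˡ-≤ 0# 0≤1 ⟩
      1# + 0#          ≈⟨ +-comm 1# 0# ⟩
      0# + 1#          ≲⟨ +-monoˡ-≤ 1# (fromℕ≥0 n) ⟩
      fromℕ R n + 1#   ≈⟨ +-comm (fromℕ R n) 1# ⟩
      fromℕ R (suc n)  ∎

    fromℕ≡×1 : ∀ n → fromℕ R n ≡ n · 1#
    fromℕ≡×1 zero    = ≡.refl
    fromℕ≡×1 (suc n) = cong (1# +_) (fromℕ≡×1 n)

    fromℕ-* : ∀ m n → fromℕ R (m ℕ.* n) ≈ fromℕ R m * fromℕ R n
    fromℕ-* m n rewrite fromℕ≡×1 (m ℕ.* n) | fromℕ≡×1 m | fromℕ≡×1 n = ×1-homo-* m n

  module Scaling {_⊑_ : Carrier → Carrier → Set} (⊑-isPreorder : IsPreorder _≈_ _⊑_)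
                 (*-monoʳ-⊑ : ∀ {c x y} → 0# ≤ c → x ⊑ y → (c * x) ⊑ (c * y))
                 {f : ℕ → Carrier} (f≥0 : Nonnegative R f) (f-mult : Multiplicative R f)
                 where

    ⊑-preorder : Preorder 0ℓ 0ℓ 0ℓ
    ⊑-preorder = record { isPreorder = ⊑-isPreorder }

    open import Relation.Binary.Reasoning.Preorder ⊑-preorder

    *-monoˡ-⊑ : ∀ {c x y} → 0# ≤ c → x ⊑ y → (x * c) ⊑ (y * c)
    *-monoˡ-⊑ {c} {x} {y} 0≤c x⊑y = begin
      x * c  ≈⟨ *-comm x c ⟩
      c * x  ≲⟨ *-monoʳ-⊑ 0≤c x⊑y ⟩
      c * y  ≈⟨ *-comm c y ⟩
      y * c  ∎

    f-split : ∀ {p r} → Prime p → p ∤ r → ∀ b → f (p ℕ.^ b ℕ.* r) ≈ f (p ℕ.^ b) * f r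
    f-split p-prime p∤r b = f-mult _ _ (ℕ.m^n>0 _ {{prime⇒nonZero p-prime}} b) (∤⇒≥1 p∤r)
                              (coprime-^ˡ (prime∤⇒coprime p-prime p∤r) b)

    f-prime-* : (∀ p → Prime p → ∀ a b → f (p ℕ.^ (a ℕ.+ b)) ⊑ (fromℕ R (p ℕ.^ a) * f (p ℕ.^ b))) →
                ∀ {p} → Prime p → ∀ k → 1 ℕ.≤ k → f (p ℕ.* k) ⊑ (fromℕ R p * f k)
    f-prime-* f-prime-power {p} p-prime k k≥1
      with b , r , p∤r , ≡.refl ← split-power (prime⇒>1 p-prime) k {{ℕ.>-nonZero k≥1}} = begin
      f (p ℕ.* (p ℕ.^ b ℕ.* r))              ≡⟨ cong f (ℕ.*-assoc p (p ℕ.^ b) r) ⟨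
      f (p ℕ.^ (1 ℕ.+ b) ℕ.* r)              ≈⟨ f-split p-prime p∤r (1 ℕ.+ b) ⟩
      f (p ℕ.^ (1 ℕ.+ b)) * f r              ≲⟨ *-monoˡ-⊑ (f≥0 r (∤⇒≥1 p∤r)) (f-prime-power p p-prime 1 b) ⟩
      fromℕ R (p ℕ.^ 1) * f (p ℕ.^ b) * f r  ≡⟨ cong (λ q → fromℕ R q * f (p ℕ.^ b) * f r) (ℕ.*-identityʳ p) ⟩
      fromℕ R p * f (p ℕ.^ b) * f r          ≈⟨ *-assoc (fromℕ R p) (f (p ℕ.^ b)) (f r) ⟩
      fromℕ R p * (f (p ℕ.^ b) * f r)        ≈⟨ *-congˡ (f-split p-prime p∤r b) ⟨
      fromℕ R p * f (p ℕ.^ b ℕ.* r)          ∎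

    module _ (f-p* : ∀ {p} → Prime p → ∀ k → 1 ℕ.≤ k → f (p ℕ.* k) ⊑ (fromℕ R p * f k)) where

      f-product-* : ∀ {ps} → All Prime ps → ∀ n → 1 ℕ.≤ n →
                    f (product ps ℕ.* n) ⊑ (fromℕ R (product ps) * f n)
      f-product-* [] n _ = begin
        f (1 ℕ.* n)      ≡⟨ cong f (ℕ.*-identityˡ n) ⟩
        f n              ≈⟨ *-identityˡ (f n) ⟨
        1# * f n         ≈⟨ *-congʳ (+-identityʳ 1#) ⟨
        fromℕ R 1 * f n  ∎
      f-product-* {p ∷ ps} (p-prime ∷ ps-prime) n n≥1 = begin
        f (p ℕ.* P ℕ.* n)              ≡⟨ cong f (ℕ.*-assoc p P n) ⟩
        f (p ℕ.* (P ℕ.* n))            ≲⟨ f-p* p-prime (P ℕ.* n) (ℕ.*-mono-≤ (productOfPrimes≥1 ps-prime) n≥1) ⟩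
        fromℕ R p * f (P ℕ.* n)        ≲⟨ *-monoʳ-⊑ (fromℕ≥0 p) (f-product-* ps-prime n n≥1) ⟩
        fromℕ R p * (fromℕ R P * f n)  ≈⟨ *-assoc (fromℕ R p) (fromℕ R P) (f n) ⟨
        fromℕ R p * fromℕ R P * f n    ≈⟨ *-congʳ (fromℕ-* p P) ⟨
        fromℕ R (p ℕ.* P) * f n        ∎
        where P = product ps

      f-* : ∀ m n → 1 ℕ.≤ m → 1 ℕ.≤ n → f (m ℕ.* n) ⊑ (fromℕ R m * f n)
      f-* m n m≥1 n≥1 = ≡.subst (λ x → f (x ℕ.* n) ⊑ (fromℕ R x * f n)) (≡.sym m≡Πps)
                          (f-product-* ps-prime n n≥1)
        where open PrimeFactorisation (factorise m {{ℕ.>-nonZero m≥1}})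
                renaming (isFactorisation to m≡Πps; factorsPrime to ps-prime)

theorem8 : (R : RealField) → (f : ℕ → RealField.Carrier R) →
    Nonnegative R f → Multiplicative R f →
    RealField._≈_ R (f 1) (RealField.1# R) →
    (PrimePowerSub R f → SubHomogeneous R f) ×
    (PrimePowerSuper R f → SuperHomogeneous R f)
theorem8 R f f≥0 f-mult _ =
    (λ sub   → Sub.f-* (Sub.f-prime-* sub))
  , (λ super → Super.f-* (Super.f-prime-* super))
  where
  module Sub   = Scaling R (≤-isPreorder R) (*-monoʳ-≤-nonNeg R) f≥0 f-mult
  module Super = Scaling R (Flip.isPreorder (≤-isPreorder R)) (*-monoʳ-≤-nonNeg R) f≥0 f-mult
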